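{- For every integer $h\ge1$, let $T_h$ be the complete binary tree of height $h$ (with $2^{h+1}-1$ vertices). Then $\mathcal{L}^m(T_h)=h$.
   Context: Lions and contamination game. Let $G=(V,E)$ be a finite graph, $N(v)$ the set of neighbours of $v$. A lion strategy with $k\ge 1$ lions consists of initial positions $p_1(0),\dots,p_k(0)\in V$ and, for each $t\ge 1$, positions $p_i(t)\in\{p_i(t-1)\}\cup N(p_i(t-1))$. Put $L_t=\{p_i(t)\}_i$, $\pi_t=\{(p_i(t-1),p_i(t))\}_i$. Contaminated sets: $W_0=V\setminus L_0$, and for $t\ge1$, $W_t=(W_{t-1}\setminus L_t)\cup\{v\in V\setminus L_t:\exists w\in W_{t-1}\cap N(v)\text{ with }(v,w)\notin\pi_t,(w,v)\notin\pi_t\}$. The strategy clears $G$ if $W_T=\emptyset$ for some $T$. It is monotone if $W_t\subseteq W_{t-1}$ for all $t\ge1$. The monotone lion number $\mathcal{L}^m(G)$ is the minimum number of lions of a monotone strategy clearing $G$. -}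

module Defs where

open import Data.Nat using (ℕ; zero; suc; _+_; _*_; _∸_; _^_; _≤_)
open import Data.Fin using (Fin; toℕ)
open import Data.Product using (Σ; ∃; _×_; _,_)
open import Data.Sum using (_⊎_)
open import Data.Empty using (⊥)
open import Relation.Nullary using (¬_)
open import Relation.Binary.PropositionalEquality using (_≡_)

record Graph : Set₁ where
  field
    n   : ℕ
    Adj : Fin n → Fin n → Set

open Graph public

record Strategy (G : Graph) (k : ℕ) : Set where
  field
    pos  : ℕ → Fin k → Fin (n G)
    move : ∀ t i → (pos (suc t) i ≡ pos t i) ⊎ Adj G (pos t i) (pos (suc t) i)

open Strategy public

module _ {G : Graph} {k : ℕ} (S : Strategy G k) where

  Occupied : ℕ → Fin (n G) → Set
  Occupied t v = ∃ λ i → pos S t i ≡ v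

  Moved : ℕ → Fin (n G) → Fin (n G) → Set
  Moved t u v = ∃ λ i → (pos S t i ≡ u) × (pos S (suc t) i ≡ v)

  Contaminated : ℕ → Fin (n G) → Set
  Contaminated zero v = ¬ Occupied zero v
  Contaminated (suc t) v =
    ¬ Occupied (suc t) v ×
    (Contaminated t v ⊎
     (∃ λ w → Contaminated t w × Adj G v w × ¬ Moved t v w × ¬ Moved t w v))

  Clears : Set
  Clears = ∃ λ T → ∀ v → ¬ Contaminated T v

  Monotone : Set
  Monotone = ∀ t v → Contaminated (suc t) v → Contaminated t v

MonotoneClearable : Graph → ℕ → Set
MonotoneClearable G k = Σ (Strategy G k) λ S → Monotone S × Clears S

MonotoneLionNumber : Graph → ℕ → Set
MonotoneLionNumber G m =
  (1 ≤ m × MonotoneClearable G m) ×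
  (∀ k → 1 ≤ k → MonotoneClearable G k → m ≤ k)

-- Complete binary tree of height h, heap indexing: vertices 0 .. 2^(h+1)-2,
-- children of vertex i are 2i+1 and 2i+2.
ChildOf : {m : ℕ} → Fin m → Fin m → Set
ChildOf u v = (toℕ v ≡ 2 * toℕ u + 1) ⊎ (toℕ v ≡ 2 * toℕ u + 2)

BinaryTree : ℕ → Graph
BinaryTree h = record
  { n   = 2 ^ (h + 1) ∸ 1
  ; Adj = λ u v → ChildOf u v ⊎ ChildOf v u
  }

-- All h lions start on the leftmost leaf and climb the leftmost
-- path.  At each vertex of that path the lowest lion stays put while the others,
-- strung along the path down to a moving tip, search the right subtree depth
-- first.  A vertex is vacated only once all its other neighbours have been
-- visited, so every visited vertex stays clean and the strategy is monotone.
--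
-- Let T(p) be the first time the subtree at p is entirely clean.
-- Cleanness spreads through unoccupied vertices, so before T(p) the subtree holds
-- a lion or is entirely contaminated, and lions can enter an entirely
-- contaminated subtree only while its parent is clean.  Comparing the two child
-- subtrees of p by their first clean times and inducting on the height j gives a
-- moment before T(p) with j + 1 lions in the subtree, or j lions while its parent
-- is clean; at the root this means h lions.

module Submission where

open import Defs
open import Data.Bool using (Bool; true; false)
import Data.Bool.Properties as Bool
open import Data.Fin using (Fin; toℕ; fromℕ<; fromℕ) renaming (zero to fzero; suc to fsuc)
open import Data.Fin.Properties using (toℕ-injective; toℕ-fromℕ<; toℕ<n; injective⇒≤; toℕ-fromℕ)
open import Data.Empty using (⊥)
open import Data.Unit using (⊤; tt)
open import Function.Definitions using (Injective)
open import Relation.Unary using (Pred; _⊆_; _⊆′_; _∪_; ｛_｝)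
open import Data.List using (List; []; _∷_; _++_; _∷ʳ_; length; drop; replicate)
open import Data.List.Properties
  using (∷-injectiveˡ; ∷-injectiveʳ; ∷ʳ-++; length-++-≤ʳ; length-drop; length-replicate; ++-identityʳ; ≡-dec)
open import Data.List.Reverse using (reverseView; []; _∶_∶ʳ_)
open import Data.Nat
open import Data.Nat.Properties
open import Data.Product using (∃; _×_; _,_; proj₁; proj₂)
open import Data.Sum using (_⊎_; inj₁; inj₂; fromInj₁)
open import Relation.Binary.PropositionalEquality
open import Relation.Nullary using (¬_; contradiction; yes; no)
open import Relation.Nullary.Decidable using (¬¬-excluded-middle; decidable-stable)
open import Relation.Nullary.Negation using (¬¬-Monad)
open import Effect.Monad using (RawMonad)
open import Level using (0ℓ)
open import Function using (case_of_; _∘_)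

-- Contamination need not be decidable on an arbitrary graph, so the lower bound is
-- argued in the double-negation monad; its conclusion h ≤ k is decidable.
open RawMonad (¬¬-Monad {0ℓ})

Least : (ℕ → Set) → ℕ → Set
Least P m = P m × (∀ m′ → P m′ → m ≤ m′)

¬¬-least : ∀ {P : ℕ → Set} {n} → P n → ¬ ¬ ∃ (Least P)
¬¬-least {P} {n} Pn = do
  inj₂ least ← none-below-or-least (suc n)
    where inj₁ none → contradiction Pn (none n ≤-refl)
  pure least
  where
  none-below-or-least : ∀ n → ¬ ¬ ((∀ m → m < n → ¬ P m) ⊎ ∃ (Least P))
  none-below-or-least zero    = pure (inj₁ λ _ ())
  none-below-or-least (suc n) = do
    inj₁ none ← none-below-or-least n
      where inj₂ least → pure (inj₂ least)
    no ¬Pn ← ¬¬-excluded-middle {A = P n}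
      where yes Pn → pure (inj₂ (n , Pn , λ m′ Pm′ → ≮⇒≥ λ m′<n → none m′ m′<n Pm′))
    pure (inj₁ λ m m<1+n → case m≤n⇒m<n∨m≡n (m<1+n⇒m≤n m<1+n) of λ where
      (inj₁ m<n)  → none m m<n
      (inj₂ refl) → ¬Pn)

-- Paths and heap indices

-- A vertex is addressed by the turns on its way up to the root, deepest turn
-- first (false = left child).
Path : Set
Path = List Bool

-- p ⊑ w : the vertex w lies in the subtree rooted at p
infix 4 _⊑_
_⊑_ : Path → Path → Set
p ⊑ w = ∃ λ q → q ++ p ≡ w

⊑-refl : ∀ {p} → p ⊑ p
⊑-refl = [] , refl

⊑-∷ : ∀ {p w} b → p ⊑ w → p ⊑ b ∷ w
⊑-∷ b (q , eq) = b ∷ q , cong (b ∷_) eq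

∷⊑⇒⊑ : ∀ {b p w} → b ∷ p ⊑ w → p ⊑ w
∷⊑⇒⊑ {b} {p} (q , eq) = q ∷ʳ b , trans (∷ʳ-++ q b p) eq

⊑⇒length≤ : ∀ {p w} → p ⊑ w → length p ≤ length w
⊑⇒length≤ {p} (q , refl) = length-++-≤ʳ p {q}

∷⊑⇒≢ : ∀ {b p w} → b ∷ p ⊑ w → w ≢ p
∷⊑⇒≢ b∷p⊑w refl = 1+n≰n (⊑⇒length≤ b∷p⊑w)

⊑[]⇒≡[] : ∀ {p} → p ⊑ [] → p ≡ []
⊑[]⇒≡[] ([] , eq) = eq

⊑-∷⁻ : ∀ {p b w} → p ⊑ b ∷ w → b ∷ w ≡ p ⊎ p ⊑ w
⊑-∷⁻ ([] , eq)    = inj₁ (sym eq)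
⊑-∷⁻ (_ ∷ q , eq) = inj₂ (q , ∷-injectiveʳ eq)

⊑-split : ∀ {p w} → p ⊑ w → w ≡ p ⊎ ∃ λ b → b ∷ p ⊑ w
⊑-split {p} (q , eq) with reverseView q
... | []            = inj₁ (sym eq)
... | q′ ∶ _ ∶ʳ b   = inj₂ (b , q′ , trans (sym (∷ʳ-++ q′ b p)) eq)

⊑-unique : ∀ {p p′ w} → p ⊑ w → p′ ⊑ w → length p ≡ length p′ → p ≡ p′
⊑-unique {w = []} p⊑w p′⊑w _ = trans (⊑[]⇒≡[] p⊑w) (sym (⊑[]⇒≡[] p′⊑w))
⊑-unique {w = b ∷ w} p⊑w p′⊑w eq with ⊑-∷⁻ p⊑w | ⊑-∷⁻ p′⊑w
... | inj₁ e | inj₁ e′    = trans (sym e) e′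
... | inj₁ refl | inj₂ p′⊑ = contradiction (≤-trans (≤-reflexive eq) (⊑⇒length≤ p′⊑)) 1+n≰n
... | inj₂ p⊑ | inj₁ refl  = contradiction (≤-trans (≤-reflexive (sym eq)) (⊑⇒length≤ p⊑)) 1+n≰n
... | inj₂ p⊑ | inj₂ p′⊑   = ⊑-unique p⊑ p′⊑ eq

∷⊑-disjoint : ∀ {x y p w} → x ∷ p ⊑ w → y ∷ p ⊑ w → x ≡ y
∷⊑-disjoint x∷p⊑w y∷p⊑w = ∷-injectiveˡ (⊑-unique x∷p⊑w y∷p⊑w refl)

infix 4 _~_
data _~_ (p q : Path) : Set where
  down : ∀ b → q ≡ b ∷ p → p ~ q
  up   : ∀ b → p ≡ b ∷ q → p ~ q

child : Bool → ℕ → ℕ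
child false i = suc (2 * i)
child true  i = suc (suc (2 * i))

index : Path → ℕ
index []      = 0
index (b ∷ p) = child b (index p)

child-injective : ∀ b c {i j} → child b i ≡ child c j → b ≡ c × i ≡ j
child-injective false false eq = refl , *-cancelˡ-≡ _ _ 2 (suc-injective eq)
child-injective true  true  eq = refl , *-cancelˡ-≡ _ _ 2 (suc-injective (suc-injective eq))
child-injective false true  {i} {j} eq = contradiction (suc-injective eq) (even≢odd i j)
child-injective true  false {i} {j} eq = contradiction (sym (suc-injective eq)) (even≢odd j i)

index-injective : ∀ {p q} → index p ≡ index q → p ≡ q
index-injective {[]}        {[]}        _  = refl
index-injective {[]}        {false ∷ _} ()
index-injective {[]}        {true ∷ _}  ()
index-injective {false ∷ _} {[]}        ()
index-injective {true ∷ _}  {[]}        ()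
index-injective {b ∷ p}     {c ∷ q}     eq with child-injective b c eq
... | refl , eq′ = cong (b ∷_) (index-injective eq′)

next : Path → Path
next []          = false ∷ []
next (false ∷ p) = true ∷ p
next (true ∷ p)  = false ∷ next p

index-next : ∀ p → index (next p) ≡ suc (index p)
index-next []          = refl
index-next (false ∷ p) = refl
index-next (true ∷ p)  = cong suc (trans (cong (2 *_) (index-next p)) (*-suc 2 (index p)))

fromIndex : ℕ → Path
fromIndex zero    = []
fromIndex (suc i) = next (fromIndex i)

index-fromIndex : ∀ i → index (fromIndex i) ≡ i
index-fromIndex zero    = refl
index-fromIndex (suc i) = trans (index-next (fromIndex i)) (cong suc (index-fromIndex i))

2^length≤1+index : ∀ p → 2 ^ length p ≤ suc (index p)
2^length≤1+index []      = ≤-refl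
2^length≤1+index (b ∷ p) = begin
  2 * 2 ^ length p            ≤⟨ *-monoʳ-≤ 2 (2^length≤1+index p) ⟩
  2 * suc (index p)           ≡⟨ *-suc 2 (index p) ⟩
  suc (child false (index p)) ≤⟨ s≤s (child-false≤ b) ⟩
  suc (child b (index p))     ∎
  where
  open ≤-Reasoning
  child-false≤ : ∀ b → child false (index p) ≤ child b (index p)
  child-false≤ false = ≤-refl
  child-false≤ true  = n≤1+n _

1+index<2^1+length : ∀ p → suc (index p) < 2 ^ (length p + 1)
1+index<2^1+length []      = ≤-refl
1+index<2^1+length (b ∷ p) = begin
  suc (suc (child b (index p))) ≤⟨ s≤s (s≤s (child≤true b)) ⟩
  2 + (2 + 2 * index p)         ≡⟨ cong (2 +_) (*-suc 2 (index p)) ⟨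
  2 + 2 * suc (index p)         ≡⟨ *-suc 2 (suc (index p)) ⟨
  2 * suc (suc (index p))       ≤⟨ *-monoʳ-≤ 2 (1+index<2^1+length p) ⟩
  2 * 2 ^ (length p + 1)        ∎
  where
  open ≤-Reasoning
  child≤true : ∀ b → child b (index p) ≤ child true (index p)
  child≤true false = n≤1+n _
  child≤true true  = ≤-refl

index<size : ∀ {h} p → length p ≤ h → index p < 2 ^ (h + 1) ∸ 1
index<size {h} p le = m+n≤o⇒m≤o∸n (suc (index p)) (begin
  suc (index p) + 1   ≡⟨ +-comm _ 1 ⟩
  suc (suc (index p)) ≤⟨ 1+index<2^1+length p ⟩
  2 ^ (length p + 1)  ≤⟨ ^-monoʳ-≤ 2 (+-monoˡ-≤ 1 le) ⟩
  2 ^ (h + 1)         ∎)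
  where open ≤-Reasoning

index<size⇒length≤ : ∀ {h} p → index p < 2 ^ (h + 1) ∸ 1 → length p ≤ h
index<size⇒length≤ {h} p lt = ≮⇒≥ λ h<len →
  <⇒≱ 2^length<2^[h+1] (^-monoʳ-≤ 2 (≤-trans (≤-reflexive (+-comm h 1)) h<len))
  where
  open ≤-Reasoning
  2^length<2^[h+1] : 2 ^ length p < 2 ^ (h + 1)
  2^length<2^[h+1] = begin-strict
    2 ^ length p      ≤⟨ 2^length≤1+index p ⟩
    suc (index p)     <⟨ ≤-reflexive (+-comm 1 _) ⟩
    suc (index p) + 1 ≤⟨ m≤o∸n⇒m+n≤o (suc (index p)) (m^n>0 2 (h + 1)) lt ⟩
    2 ^ (h + 1)       ∎

childOf⇒child : ∀ {m} {u v : Fin m} → ChildOf u v → ∃ λ b → toℕ v ≡ child b (toℕ u)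
childOf⇒child (inj₁ eq) = false , trans eq (+-comm _ 1)
childOf⇒child (inj₂ eq) = true  , trans eq (+-comm _ 2)

child⇒childOf : ∀ {m} {u v : Fin m} b → toℕ v ≡ child b (toℕ u) → ChildOf u v
child⇒childOf false eq = inj₁ (trans eq (+-comm 1 _))
child⇒childOf true  eq = inj₂ (trans eq (+-comm 2 _))

module HeapTree (h : ℕ) where

  Vertex : Set
  Vertex = Fin (n (BinaryTree h))

  path : Vertex → Path
  path v = fromIndex (toℕ v)

  index-path : ∀ v → index (path v) ≡ toℕ v
  index-path v = index-fromIndex (toℕ v)

  path-injective : ∀ {v w} → path v ≡ path w → v ≡ w
  path-injective {v} {w} eq = toℕ-injective (trans (sym (index-path v)) (trans (cong index eq) (index-path w)))

  length-path : ∀ v → length (path v) ≤ h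
  length-path v = index<size⇒length≤ (path v) (subst (_< n (BinaryTree h)) (sym (index-path v)) (toℕ<n v))

  vertex : ∀ p → length p ≤ h → Vertex
  vertex p le = fromℕ< (index<size p le)

  path-vertex : ∀ p le → path (vertex p le) ≡ p
  path-vertex p le = index-injective (trans (index-path (vertex p le)) (toℕ-fromℕ< (index<size p le)))

  child⇒path : ∀ {v w} b → toℕ w ≡ child b (toℕ v) → path w ≡ b ∷ path v
  child⇒path {v} {w} b eq = index-injective (trans (index-path w) (trans eq (cong (child b) (sym (index-path v)))))

  path⇒child : ∀ {v w} b → path w ≡ b ∷ path v → toℕ w ≡ child b (toℕ v)
  path⇒child {v} {w} b eq = trans (sym (index-path w)) (trans (cong index eq) (cong (child b) (index-path v)))

  adj⇒~ : ∀ {v w} → Adj (BinaryTree h) v w → path v ~ path w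
  adj⇒~ {v} {w} (inj₁ c) with b , eq ← childOf⇒child {u = v} {w} c = down b (child⇒path b eq)
  adj⇒~ {v} {w} (inj₂ c) with b , eq ← childOf⇒child {u = w} {v} c = up b (child⇒path b eq)

  ~⇒adj : ∀ {v w} → path v ~ path w → Adj (BinaryTree h) v w
  ~⇒adj {v} {w} (down b eq) = inj₁ (child⇒childOf {u = v} {w} b (path⇒child b eq))
  ~⇒adj {v} {w} (up b eq)   = inj₂ (child⇒childOf {u = w} {v} b (path⇒child b eq))

-- Strategies on an arbitrary graph

module _ {G : Graph} {k : ℕ} (S : Strategy G k) where

  Clean : ℕ → Fin (n G) → Set
  Clean t v = ¬ Contaminated S t v

  contaminated⇒unoccupied : ∀ t {v} → Contaminated S t v → ¬ Occupied S t v
  contaminated⇒unoccupied zero    c = c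
  contaminated⇒unoccupied (suc t) c = proj₁ c

  occupied⇒clean : ∀ t {v} → Occupied S t v → Clean t v
  occupied⇒clean t o c = contaminated⇒unoccupied t c o

  clean-backward : ∀ t {v} → Clean (suc t) v → ¬ Occupied S (suc t) v → Clean t v
  clean-backward t c ¬o w = c (¬o , inj₁ w)

  module _ (mono : Monotone S) where

    clean-suc : ∀ {t v} → Clean t v → Clean (suc t) v
    clean-suc {t} {v} c w = c (mono t v w)

    clean-mono : ∀ {t t′ v} → t ≤ t′ → Clean t v → Clean t′ v
    clean-mono {t} {v = v} t≤t′ c = go (≤⇒≤′ t≤t′)
      where
      go : ∀ {t′} → t ≤′ t′ → Clean t′ v
      go ≤′-refl       = c
      go (≤′-step t≤t′) = clean-suc (go t≤t′)

    clean-spreads : ∀ t {v w} → Clean t v → ¬ Occupied S t v → Adj G v w → Clean t w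
    clean-spreads zero    c ¬o _   _ = c ¬o
    clean-spreads (suc t) {v} {w} c ¬o adj cw =
      c (¬o , inj₂ (w , mono t w cw , adj , ¬v→w , ¬w→v))
      where
      ¬v→w : ¬ Moved S t v w
      ¬v→w (i , _ , at-w) = contaminated⇒unoccupied (suc t) cw (i , at-w)
      ¬w→v : ¬ Moved S t w v
      ¬w→v (i , _ , at-v) = ¬o (i , at-v)

  Visited : ℕ → Fin (n G) → Set
  Visited t v = ∃ λ s → s ≤ t × Occupied S s v

  visited-suc : ∀ {t v} → Visited t v → Visited (suc t) v
  visited-suc (s , s≤t , o) = s , m≤n⇒m≤1+n s≤t , o

  visited-backward : ∀ {t v} → Visited (suc t) v → ¬ Occupied S (suc t) v → Visited t v
  visited-backward (s , s≤1+t , o) ¬o with m≤n⇒m<n∨m≡n s≤1+t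
  ... | inj₁ s<1+t = s , m<1+n⇒m≤n s<1+t , o
  ... | inj₂ refl  = contradiction o ¬o

  SafeVacating : Set
  SafeVacating = ∀ t v → Occupied S t v → ¬ Occupied S (suc t) v →
                 ∀ w → Adj G v w → Visited t w ⊎ Moved S t v w

  module _ (safe : SafeVacating) where

    -- The second half is what keeps a visited vertex clean once its lions have left.
    visited⇒clean×shielded : ∀ t →
      (∀ v → Visited t v → Clean t v) ×
      (∀ v w → Visited t v → ¬ Occupied S t v → Adj G v w → ¬ ¬ Visited t w)
    visited⇒clean×shielded zero = clean₀ , shielded₀
      where
      clean₀ : ∀ v → Visited 0 v → Clean 0 v
      clean₀ v (zero , _ , o) c = c o
      shielded₀ : ∀ v w → Visited 0 v → ¬ Occupied S 0 v → Adj G v w → ¬ ¬ Visited 0 w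
      shielded₀ v w (zero , _ , o) ¬o = contradiction o ¬o
    visited⇒clean×shielded (suc t) = clean′ , shielded′
      where
      clean : ∀ v → Visited t v → Clean t v
      clean = proj₁ (visited⇒clean×shielded t)
      shielded : ∀ v w → Visited t v → ¬ Occupied S t v → Adj G v w → ¬ ¬ Visited t w
      shielded = proj₂ (visited⇒clean×shielded t)

      clean′ : ∀ v → Visited (suc t) v → Clean (suc t) v
      clean′ v vis (¬o , inj₁ cv) = clean v (visited-backward vis ¬o) cv
      clean′ v vis (¬o , inj₂ (w , cw , adj , ¬v→w , _)) = ¬¬visited-w λ vis-w → clean w vis-w cw
        where
        ¬¬visited-w : ¬ ¬ Visited t w
        ¬¬visited-w = do
          yes o ← ¬¬-excluded-middle {A = Occupied S t v}
            where no ¬oₜ → shielded v w (visited-backward vis ¬o) ¬oₜ adj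
          pure (fromInj₁ (λ v→w → contradiction v→w ¬v→w) (safe t v o ¬o w adj))

      shielded′ : ∀ v w → Visited (suc t) v → ¬ Occupied S (suc t) v → Adj G v w → ¬ ¬ Visited (suc t) w
      shielded′ v w vis ¬o adj = do
        yes o ← ¬¬-excluded-middle {A = Occupied S t v}
          where no ¬oₜ → visited-suc <$> shielded v w (visited-backward vis ¬o) ¬oₜ adj
        pure (moved-or-visited (safe t v o ¬o w adj))
        where
        moved-or-visited : Visited t w ⊎ Moved S t v w → Visited (suc t) w
        moved-or-visited (inj₁ vis-w)         = visited-suc vis-w
        moved-or-visited (inj₂ (i , _ , at-w)) = suc t , ≤-refl , i , at-w

    visited⇒clean : ∀ t v → Visited t v → Clean t v
    visited⇒clean t = proj₁ (visited⇒clean×shielded t)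

    unvisited⇒contaminated : ∀ t v → ¬ Visited t v → Contaminated S t v
    unvisited⇒contaminated zero    v ¬vis = λ o → ¬vis (0 , ≤-refl , o)
    unvisited⇒contaminated (suc t) v ¬vis =
      (λ o → ¬vis (suc t , ≤-refl , o)) ,
      inj₁ (unvisited⇒contaminated t v (λ vis → ¬vis (visited-suc vis)))

    safe⇒monotone : Monotone S
    safe⇒monotone t v c =
      unvisited⇒contaminated t v (λ vis → visited⇒clean (suc t) v (visited-suc vis) c)

    safe⇒clears : ∀ T → (∀ v → Visited T v) → Clears S
    safe⇒clears T all-visited = T , λ v → visited⇒clean T v (all-visited v)

-- The lower bound

module LowerBound {h k : ℕ} (S : Strategy (BinaryTree h) k) (mono : Monotone S) where
  open HeapTree h

  Subtree : Path → Pred Vertex 0ℓ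
  Subtree p v = p ⊑ path v

  ProperSubtree : Path → Pred Vertex 0ℓ
  ProperSubtree p v = ∃ λ b → Subtree (b ∷ p) v

  SubtreeClean : ℕ → Path → Set
  SubtreeClean t p = ∀ v → Subtree p v → Clean S t v

  SubtreeUnclean : ℕ → Path → Set
  SubtreeUnclean t p = ∀ v → Subtree p v → ¬ Clean S t v

  ParentClean : ℕ → Path → Set
  ParentClean t []      = ⊤
  ParentClean t (_ ∷ p) = ∀ v → path v ≡ p → Clean S t v

  LionIn : ℕ → Path → Set
  LionIn t p = ∃ λ i → Subtree p (pos S t i)

  FirstClean : Path → ℕ → Set
  FirstClean p = Least λ T → SubtreeClean T p

  vertexOf : ∀ p → length p ≤ h → ∃ λ u → path u ≡ p
  vertexOf p le = vertex p le , path-vertex p le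

  vertexAt : ∀ {p} v → p ⊑ path v → ∃ λ u → path u ≡ p
  vertexAt {p} v p⊑v = vertexOf p (≤-trans (⊑⇒length≤ p⊑v) (length-path v))

  first-clean-child≤ : ∀ {b p T T′} → FirstClean p T → FirstClean (b ∷ p) T′ → T′ ≤ T
  first-clean-child≤ (clean , _) (_ , least) = least _ λ v → clean v ∘ ∷⊑⇒⊑

  lionless⇒unoccupied : ∀ {t p v} → ¬ LionIn t p → Subtree p v → ¬ Occupied S t v
  lionless⇒unoccupied no-lion p⊑v (i , refl) = no-lion (i , p⊑v)

  clean-root⇒subtree-clean : ∀ {t p} u → path u ≡ p → Clean S t u → ¬ LionIn t p → SubtreeClean t p
  clean-root⇒subtree-clean {t} {p} u refl cu no-lion v (q , eq) = go q v eq
    where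
    go : ∀ q v → q ++ p ≡ path v → Clean S t v
    go []      v eq = subst (Clean S t) (path-injective eq) cu
    go (b ∷ q) v eq with w , w≡ ← vertexAt v (b ∷ [] , eq) =
      clean-spreads S mono t (go q w (sym w≡))
        (lionless⇒unoccupied no-lion (q , sym w≡))
        (~⇒adj (down b (trans (sym eq) (cong (b ∷_) (sym w≡)))))

  clean-in-subtree⇒root-clean : ∀ {t p} v u → ¬ LionIn t p → Subtree p v → Clean S t v →
                                path u ≡ p → Clean S t u
  clean-in-subtree⇒root-clean {t} {p} v u no-lion (q , eq) cv refl = go q v eq cv
    where
    go : ∀ q v → q ++ p ≡ path v → Clean S t v → Clean S t u
    go []      v eq cv = subst (Clean S t) (path-injective (sym eq)) cv
    go (b ∷ q) v eq cv with w , w≡ ← vertexAt v (b ∷ [] , eq) =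
      go q w (sym w≡) (clean-spreads S mono t cv
        (lionless⇒unoccupied no-lion (b ∷ q , eq))
        (~⇒adj (up b (trans (sym eq) (cong (b ∷_) (sym w≡))))))

  partly-clean⇒lion : ∀ {t p} v → Subtree p v → Clean S t v → ¬ SubtreeClean t p → ¬ ¬ LionIn t p
  partly-clean⇒lion v p⊑v cv not-all-clean no-lion with u , u≡ ← vertexAt v p⊑v =
    not-all-clean (clean-root⇒subtree-clean u u≡ (clean-in-subtree⇒root-clean v u no-lion p⊑v cv u≡) no-lion)

  lion-at-first-clean : ∀ {p T} u → path u ≡ p → FirstClean p T → ¬ ¬ LionIn T p
  lion-at-first-clean {T = zero} u u≡ (clean , _) no-lion =
    clean u ([] , sym u≡) (lionless⇒unoccupied no-lion ([] , sym u≡))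
  lion-at-first-clean {p} {suc t} u u≡ (clean , least) no-lion =
    1+n≰n (least t λ v p⊑v cv → clean v p⊑v
      (lionless⇒unoccupied no-lion p⊑v , inj₁ cv))

  clean-before-first⇒lion : ∀ {p T t} v → FirstClean p T → t ≤ T → Subtree p v → Clean S t v →
                            ¬ ¬ LionIn t p
  clean-before-first⇒lion v first t≤T p⊑v cv with m≤n⇒m<n∨m≡n t≤T
  ... | inj₁ t<T  = partly-clean⇒lion v p⊑v cv λ all-clean → <⇒≱ t<T (proj₂ first _ all-clean)
  ... | inj₂ refl with u , u≡ ← vertexAt v p⊑v = lion-at-first-clean u u≡ first

  -- A lion can enter the subtree at y ∷ p only through p.
  unclean-subtree-stays : ∀ {s y p} u → path u ≡ p → SubtreeUnclean s (y ∷ p) →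
                          ∀ {t} → s ≤ t → ¬ Clean S t u → SubtreeUnclean t (y ∷ p)
  unclean-subtree-stays {s} {y} {p} u u≡ unclean s≤t = go (≤⇒≤′ s≤t)
    where
    go : ∀ {t} → s ≤′ t → ¬ Clean S t u → SubtreeUnclean t (y ∷ p)
    go ≤′-refl _ = unclean
    go {suc t} (≤′-step s≤t) ¬cu′ v in-v cv = ¬¬-excluded-middle λ where
        (no ¬o)          → ih v in-v (clean-backward S t cv ¬o)
        (yes (i , at-v)) → lion-entered i at-v (move S t i)
      where
      ¬cu : ¬ Clean S t u
      ¬cu = ¬cu′ ∘ clean-suc S mono
      ih : SubtreeUnclean t (y ∷ p)
      ih = go s≤t ¬cu
      lion-entered : ∀ i → pos S (suc t) i ≡ v →
                     pos S (suc t) i ≡ pos S t i ⊎ Adj (BinaryTree h) (pos S t i) (pos S (suc t) i) → ⊥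
      lion-entered i at-v (inj₁ stayed) = ih v in-v (occupied⇒clean S t (i , trans (sym stayed) at-v))
      lion-entered i at-v (inj₂ adj)    = came-from (adj⇒~ (subst (Adj (BinaryTree h) z) at-v adj))
        where
        z : Vertex
        z = pos S t i
        cz : Clean S t z
        cz = occupied⇒clean S t (i , refl)
        came-from : path z ~ path v → ⊥
        came-from (up b z≡) = ih z (subst (y ∷ p ⊑_) (sym z≡) (⊑-∷ b in-v)) cz
        came-from (down b v≡) with ⊑-∷⁻ (subst (y ∷ p ⊑_) v≡ in-v)
        ... | inj₁ b∷z≡y∷p = ¬cu (subst (Clean S t) z≡u cz)
          where
          z≡u : z ≡ u
          z≡u = path-injective (trans (∷-injectiveʳ b∷z≡y∷p) (sym u≡))
        ... | inj₂ in-z    = ih z in-z cz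

  lion-entered⇒parent-clean : ∀ {s t y p} u → path u ≡ p → SubtreeUnclean s (y ∷ p) → s ≤ t →
                              LionIn t (y ∷ p) → Clean S t u
  lion-entered⇒parent-clean u u≡ unclean s≤t (i , in-i) cu =
    unclean-subtree-stays u u≡ unclean s≤t (λ c → c cu) (pos S _ i) in-i (occupied⇒clean S _ (i , refl))

  parent-clean-or-occupied : ∀ {t p} u → path u ≡ p → Clean S t u → ¬ ¬ (ParentClean t p ⊎ Occupied S t u)
  parent-clean-or-occupied {t} {p} u u≡ cu = do
    no ¬o ← ¬¬-excluded-middle
      where yes o → pure (inj₂ o)
    pure (inj₁ (parent-clean p u≡ ¬o))
    where
    parent-clean : ∀ p → path u ≡ p → ¬ Occupied S t u → ParentClean t p
    parent-clean []      _  _  = tt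
    parent-clean (b ∷ p) u≡ ¬o v v≡ =
      clean-spreads S mono t cu ¬o (~⇒adj (up b (trans u≡ (cong (b ∷_) (sym v≡)))))

  record LionsIn (t : ℕ) (P : Pred Vertex 0ℓ) (m : ℕ) : Set where
    field
      lion     : Fin m → Fin k
      distinct : Injective _≡_ _≡_ lion
      inside   : ∀ l → P (pos S t (lion l))

  some-lion : ∀ {t P m} → LionsIn t P (suc m) → ∃ λ i → P (pos S t i)
  some-lion L = LionsIn.lion L fzero , LionsIn.inside L fzero

  lions≤k : ∀ {t P m} → LionsIn t P m → m ≤ k
  lions≤k L = injective⇒≤ (LionsIn.distinct L)

  one-lion : ∀ {t P} → (∃ λ i → P (pos S t i)) → LionsIn t P 1
  one-lion (i , in-i) = record
    { lion = λ _ → i ; distinct = λ { {fzero} {fzero} _ → refl } ; inside = λ _ → in-i }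

  lions-weaken : ∀ {t P Q m} → P ⊆′ Q → LionsIn t P m → LionsIn t Q m
  lions-weaken P⊆Q L = record { LionsIn L ; inside = λ l → P⊆Q _ (LionsIn.inside L l) }

  add-lion : ∀ {t P Q m} → P ⊆′ Q → LionsIn t P m →
             ∀ i → Q (pos S t i) → ¬ P (pos S t i) → LionsIn t Q (suc m)
  add-lion {t} {P} {Q} {m} P⊆Q L i in-i out-i = record { lion = lion′ ; distinct = distinct′ ; inside = inside′ }
    where
    open LionsIn L
    lion′ : Fin (suc m) → Fin k
    lion′ fzero    = i
    lion′ (fsuc l) = lion l
    distinct′ : Injective _≡_ _≡_ lion′
    distinct′ {fzero}  {fzero}  _  = refl
    distinct′ {fzero}  {fsuc l} eq = contradiction (subst (P ∘ pos S t) (sym eq) (inside l)) out-i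
    distinct′ {fsuc l} {fzero}  eq = contradiction (subst (P ∘ pos S t) eq (inside l)) out-i
    distinct′ {fsuc l} {fsuc l′} eq = cong fsuc (distinct eq)
    inside′ : ∀ l → Q (pos S t (lion′ l))
    inside′ fzero    = in-i
    inside′ (fsuc l) = P⊆Q _ (inside l)

  lion-beside : ∀ {t x y p Ty} u → x ≢ y → path u ≡ p → length p < h → Clean S t u →
                FirstClean (y ∷ p) Ty → t ≤ Ty →
                ¬ ¬ ∃ λ i → Subtree p (pos S t i) × ¬ Subtree (x ∷ p) (pos S t i)
  lion-beside {t} {x} {y} {p} u x≢y u≡ p<h cu first t≤Ty = do
    no ¬o ← ¬¬-excluded-middle
      where yes (i , at-u) → pure (i , at-p (pos S t i) (trans (cong path at-u) u≡))
    let c , c≡ = vertexOf (y ∷ p) p<h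
        cc = clean-spreads S mono t cu ¬o (~⇒adj (down y (trans c≡ (cong (y ∷_) (sym u≡)))))
    i , in-y ← clean-before-first⇒lion c first t≤Ty ([] , sym c≡) cc
    pure (i , ∷⊑⇒⊑ in-y , λ in-x → x≢y (∷⊑-disjoint in-x in-y))
    where
    at-p : ∀ w → path w ≡ p → Subtree p w × ¬ Subtree (x ∷ p) w
    at-p w w≡ = ([] , sym w≡) , λ in-x → ∷⊑⇒≢ in-x w≡

  lionless-before-first⇒unclean : ∀ {p T t} → FirstClean p T → t ≤ T → ¬ LionIn t p → SubtreeUnclean t p
  lionless-before-first⇒unclean first t≤T no-lion v in-v cv = clean-before-first⇒lion v first t≤T in-v cv no-lion

  record OrderedChildren (p : Path) : Set where
    field
      early late     : Bool
      early≢late     : early ≢ late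
      T-early T-late : ℕ
      first-early    : FirstClean (early ∷ p) T-early
      first-late     : FirstClean (late ∷ p) T-late
      early≤late     : T-early ≤ T-late

  EnoughLions : ℕ → Path → ℕ → Set
  EnoughLions t p m = LionsIn t (Subtree p) (suc m) ⊎ (LionsIn t (Subtree p) m × ParentClean t p)

  clean-root⇒enough-lions : ∀ {t p m} u → path u ≡ p → Clean S t u → LionsIn t (ProperSubtree p) m →
                            ¬ ¬ EnoughLions t p m
  clean-root⇒enough-lions {t} {p} u u≡ cu L = do
    inj₂ (i , at-u) ← parent-clean-or-occupied u u≡ cu
      where inj₁ pc → pure (inj₂ (lions-weaken proper⊆ L , pc))
    let i-at-p = trans (cong path at-u) u≡
    pure (inj₁ (add-lion proper⊆ L i ([] , sym i-at-p) λ (_ , in-child) → ∷⊑⇒≢ in-child i-at-p))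
    where
    proper⊆ : ProperSubtree p ⊆′ Subtree p
    proper⊆ _ (_ , in-child) = ∷⊑⇒⊑ in-child

  module _ (clears : Clears S) where

    firstClean : ∀ p → ¬ ¬ ∃ (FirstClean p)
    firstClean p = ¬¬-least (λ v _ → proj₂ clears v)

    orderChildren : ∀ p → ¬ ¬ OrderedChildren p
    orderChildren p = do
      T₀ , first₀ ← firstClean (false ∷ p)
      T₁ , first₁ ← firstClean (true ∷ p)
      pure (case ≤-total T₀ T₁ of λ where
        (inj₁ T₀≤T₁) → record
          { early≢late = λ () ; first-early = first₀ ; first-late = first₁ ; early≤late = T₀≤T₁ }
        (inj₂ T₁≤T₀) → record
          { early≢late = λ () ; first-early = first₁ ; first-late = first₀ ; early≤late = T₁≤T₀ })

    lions-after-unclean : ∀ j p → length p + j ≤ h → ∀ {s T} → FirstClean p T → SubtreeUnclean s p →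
                          ¬ ¬ ∃ λ t → s ≤ t × t ≤ T × LionsIn t (Subtree p) (suc j)
    lions-after-unclean zero p len {s} {T} first unclean = do
      let u , u≡ = vertexOf p (≤-trans (m≤m+n _ 0) len)
          u-in = [] , sym u≡
          s≤T = ≮⇒≥ λ T<s → unclean u u-in (clean-mono S mono (<⇒≤ T<s) (proj₁ first u u-in))
      lion ← lion-at-first-clean u u≡ first
      pure (T , s≤T , ≤-refl , one-lion lion)
    lions-after-unclean (suc j) p len {s} first unclean = do
      oc ← orderChildren p
      let open OrderedChildren oc
          p<h = ≤-trans (s≤s (m≤m+n _ j)) len′
          u , u≡ = vertexOf p (<⇒≤ p<h)
          unclean-early = λ v in-v → unclean v (∷⊑⇒⊑ in-v)
      t , s≤t , t≤Tx , L ← lions-after-unclean j (early ∷ p) len′ first-early unclean-early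
      let cu = lion-entered⇒parent-clean u u≡ unclean-early s≤t (some-lion L)
      i , in-p , out-early ← lion-beside u early≢late u≡ p<h cu first-late (≤-trans t≤Tx early≤late)
      pure (t , s≤t , ≤-trans t≤Tx (first-clean-child≤ first first-early) ,
            add-lion (λ _ → ∷⊑⇒⊑) L i in-p out-early)
      where
      len′ : suc (length p) + j ≤ h
      len′ = subst (_≤ h) (+-suc (length p) j) len

    lions-before-first-clean : ∀ j p → length p + j ≤ h → ∀ {T} → FirstClean p T →
                               ¬ ¬ ∃ λ t → t ≤ T × EnoughLions t p j
    lions-before-first-clean zero p len {T} first = do
      let u , u≡ = vertexOf p (≤-trans (m≤m+n _ 0) len)
      lion ← lion-at-first-clean u u≡ first
      pure (T , ≤-refl , inj₁ (one-lion lion))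
    lions-before-first-clean (suc j) p len first = do
      oc ← orderChildren p
      let open OrderedChildren oc
          late≤ = first-clean-child≤ first first-late
      t , t≤Tx , outcome ← lions-before-first-clean j (early ∷ p) len′ first-early
      let t≤Ty = ≤-trans t≤Tx early≤late
      yes (i , in-late) ← ¬¬-excluded-middle {A = LionIn t (late ∷ p)}
        where no no-lion →
                late-catches-up first-late late≤ (lionless-before-first⇒unclean first-late t≤Ty no-lion)
      let out-early = λ in-early → early≢late (∷⊑-disjoint in-early in-late)
      outcome′ ← case outcome of λ where
        (inj₁ L)        → pure (inj₁ (add-lion (λ _ → ∷⊑⇒⊑) L i (∷⊑⇒⊑ in-late) out-early))
        (inj₂ (L , pc)) → clean-root⇒enough-lions u u≡ (pc u u≡)
                             (add-lion (λ _ in-v → early , in-v) L i (late , in-late) out-early)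
      pure (t , ≤-trans t≤Ty late≤ , outcome′)
      where
      len′ : suc (length p) + j ≤ h
      len′ = subst (_≤ h) (+-suc (length p) j) len
      u : Vertex
      u = proj₁ (vertexOf p (≤-trans (m≤m+n _ _) len))
      u≡ : path u ≡ p
      u≡ = proj₂ (vertexOf p (≤-trans (m≤m+n _ _) len))
      late-catches-up : ∀ {y t Ty T} → FirstClean (y ∷ p) Ty → Ty ≤ T → SubtreeUnclean t (y ∷ p) →
                        ¬ ¬ ∃ λ t′ → t′ ≤ T × EnoughLions t′ p (suc j)
      late-catches-up {y} first-y Ty≤T unclean = do
        t′ , t≤t′ , t′≤Ty , L ← lions-after-unclean j (y ∷ p) len′ first-y unclean
        let cu = lion-entered⇒parent-clean u u≡ unclean t≤t′ (some-lion L)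
        outcome ← clean-root⇒enough-lions u u≡ cu (lions-weaken (λ _ in-v → y , in-v) L)
        pure (t′ , ≤-trans t′≤Ty Ty≤T , outcome)

    h≤k : h ≤ k
    h≤k = decidable-stable (h ≤? k) do
      T , first ← firstClean []
      _ , _ , outcome ← lions-before-first-clean h [] ≤-refl first
      pure (case outcome of λ where
        (inj₁ L)       → ≤-trans (n≤1+n h) (lions≤k L)
        (inj₂ (L , _)) → lions≤k L)

-- The upper bound

-- the ancestor of p at depth d, or p itself when d ≥ length p
ancestor : ℕ → Path → Path
ancestor d p = drop (length p ∸ d) p

ancestor-≥ : ∀ {d p} → length p ≤ d → ancestor d p ≡ p
ancestor-≥ {d} {p} le = cong (λ i → drop i p) (m≤n⇒m∸n≡0 le)

ancestor-∷ : ∀ {d} b p → d ≤ length p → ancestor d (b ∷ p) ≡ ancestor d p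
ancestor-∷ b p le = cong (λ i → drop i (b ∷ p)) (+-∸-assoc 1 le)

length-ancestor : ∀ d p → length (ancestor d p) ≤ length p
length-ancestor d p = ≤-trans (≤-reflexive (length-drop (length p ∸ d) p)) (m∸n≤m (length p) (length p ∸ d))

ancestor-child : ∀ d b p →
                 ancestor d (b ∷ p) ≡ ancestor d p ⊎ (ancestor d p ≡ p × ancestor d (b ∷ p) ≡ b ∷ p)
ancestor-child d b p with d ≤? length p
... | yes d≤p = inj₁ (ancestor-∷ b p d≤p)
... | no  d≰p = inj₂ (ancestor-≥ (<⇒≤ (≰⇒> d≰p)) , ancestor-≥ (≰⇒> d≰p))

-- Lion l stands at depth base + l on the path to the tip, or on the tip itself
-- if the tip is shallower.
record Config : Set where
  constructor ⟨_,_⟩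
  field
    tip  : Path
    base : ℕ
open Config

lionPath : Config → ℕ → Path
lionPath c l = ancestor (base c + l) (tip c)

Moves : Config → Config → Set
Moves c c′ = tip c ~ tip c′ ×
             (base c′ ≡ base c ⊎ (length (tip c) ≤ base c × length (tip c′) ≤ base c′))

lion-stays-or-follows : ∀ {c c′} → Moves c c′ → ∀ l →
                        lionPath c′ l ≡ lionPath c l ⊎ (lionPath c l ≡ tip c × lionPath c′ l ≡ tip c′)
lion-stays-or-follows {⟨ p , τ ⟩} {⟨ p′ , τ′ ⟩} (_ , inj₂ (p≤τ , p′≤τ′)) l =
  inj₂ (ancestor-≥ (≤-trans p≤τ (m≤m+n τ l)) , ancestor-≥ (≤-trans p′≤τ′ (m≤m+n τ′ l)))
lion-stays-or-follows {⟨ p , τ ⟩} {⟨ _ , _ ⟩} (down b refl , inj₁ refl) l = ancestor-child (τ + l) b p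
lion-stays-or-follows {⟨ _ , τ ⟩} {⟨ p′ , _ ⟩} (up b refl , inj₁ refl) l with ancestor-child (τ + l) b p′
... | inj₁ eq          = inj₁ (sym eq)
... | inj₂ (eq , eq′) = inj₂ (eq′ , eq)

tour : ℕ → Path → ℕ → List Config → List Config
tour zero    p τ rest = rest
tour (suc m) p τ rest =
  ⟨ false ∷ p , τ ⟩ ∷ tour m (false ∷ p) τ
    (⟨ p , τ ⟩ ∷ ⟨ true ∷ p , τ ⟩ ∷ tour m (true ∷ p) τ (⟨ p , τ ⟩ ∷ rest))

spine : ℕ → Path
spine d = replicate d false

-- While the right subtree of spine d is searched, the lowest lion guards spine d
-- against its contaminated parent.  The root has no parent, so there the lowest
-- lion may start one level down: this is why h lions suffice.
guard : ℕ → ℕ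
guard zero    = 1
guard (suc d) = suc d

1≤guard : ∀ d → 1 ≤ guard d
1≤guard zero    = ≤-refl
1≤guard (suc d) = s≤s z≤n

length-spine : ∀ d → length (spine d) ≡ d
length-spine d = length-replicate d

length-spine≤guard : ∀ d → length (spine d) ≤ guard d
length-spine≤guard zero    = z≤n
length-spine≤guard (suc d) = ≤-reflexive (length-spine (suc d))

guard≤1+length-spine : ∀ d → guard d ≤ suc (length (spine d))
guard≤1+length-spine zero    = ≤-refl
guard≤1+length-spine (suc d) = ≤-trans (n≤1+n (suc d)) (≤-reflexive (cong suc (sym (length-spine (suc d)))))

climb : ℕ → ℕ → List Config
climb zero    m = []
climb (suc d) m =
  ⟨ spine d , guard d ⟩ ∷ ⟨ true ∷ spine d , guard d ⟩ ∷
    tour m (true ∷ spine d) (guard d) (⟨ spine d , guard d ⟩ ∷ climb d (suc m))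

after : Config → List Config → ℕ → Config
after c _         zero    = c
after c []        (suc t) = c
after c (c′ ∷ cs) (suc t) = after c′ cs t

Visits : Config → List Config → ℕ → Pred Path 0ℓ
Visits c cs t w = ∃ λ s → s ≤ t × tip (after c cs s) ≡ w

module UpperBound (h′ : ℕ) where
  h : ℕ
  h = suc h′

  open HeapTree h

  Fits : Config → Set
  Fits c = length (tip c) ≤ h × 1 ≤ base c

  Guarded : Pred Path 0ℓ → Config → Config → Set
  Guarded H c c′ = (∃ λ (l : Fin h) → lionPath c′ (toℕ l) ≡ tip c) ⊎
                   (∀ w → tip c ~ w → length w ≤ h → w ≢ tip c′ → H w)

  Step : Pred Path 0ℓ → Config → Config → Set
  Step H c c′ = Fits c′ × Moves c c′ × Guarded H c c′

  -- H holds the tips visited so far, including that of c; a run ends with every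
  -- vertex visited.
  Run : Pred Path 0ℓ → Config → List Config → Set
  Run H c []        = ∀ w → length w ≤ h → H w
  Run H c (c′ ∷ cs) = Step H c c′ × Run (H ∪ ｛ tip c′ ｝) c′ cs

  Covers : Pred Path 0ℓ → Path → Set
  Covers H p = ∀ w → p ⊑ w → length w ≤ h → H w

  step-mono : ∀ {H H′ c c′} → H ⊆ H′ → Step H c c′ → Step H′ c c′
  step-mono H⊆H′ (fits , moves , inj₁ stay)    = fits , moves , inj₁ stay
  step-mono H⊆H′ (fits , moves , inj₂ visited) =
    fits , moves , inj₂ λ w adj len w≢ → H⊆H′ (visited w adj len w≢)

  covers-mono : ∀ {H H′ p} → H ⊆ H′ → Covers H p → Covers H′ p
  covers-mono H⊆H′ cov w p⊑w len = H⊆H′ (cov w p⊑w len)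

  covers-leaf : ∀ {H p} → length p ≡ h → H p → Covers H p
  covers-leaf {p = p} len Hp w p⊑w w≤h with ⊑-split p⊑w
  ... | inj₁ refl         = Hp
  ... | inj₂ (_ , b∷p⊑w) =
    contradiction (≤-trans (⊑⇒length≤ b∷p⊑w) (≤-trans w≤h (≤-reflexive (sym len)))) 1+n≰n

  covers-join : ∀ {H p} → H p → Covers H (false ∷ p) → Covers H (true ∷ p) → Covers H p
  covers-join Hp cov₀ cov₁ w p⊑w with ⊑-split p⊑w
  ... | inj₁ refl            = λ _ → Hp
  ... | inj₂ (false , in₀)   = cov₀ w in₀
  ... | inj₂ (true  , in₁)   = cov₁ w in₁

  step-down : ∀ {H p τ} b → length p < h → 1 ≤ τ → τ ≤ length p → Step H ⟨ p , τ ⟩ ⟨ b ∷ p , τ ⟩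
  step-down {p = p} {τ} b p<h 1≤τ τ≤p = (p<h , 1≤τ) , (down b refl , inj₁ refl) , inj₁ (l , stays)
    where
    open ≡-Reasoning
    l : Fin h
    l = fromℕ< (≤-<-trans (m∸n≤m (length p) τ) p<h)
    stays : lionPath ⟨ b ∷ p , τ ⟩ (toℕ l) ≡ p
    stays = begin
      ancestor (τ + toℕ l) (b ∷ p)          ≡⟨ cong (λ i → ancestor (τ + i) (b ∷ p)) (toℕ-fromℕ< _) ⟩
      ancestor (τ + (length p ∸ τ)) (b ∷ p) ≡⟨ cong (λ d → ancestor d (b ∷ p)) (m+[n∸m]≡n τ≤p) ⟩
      ancestor (length p) (b ∷ p)           ≡⟨ ancestor-∷ b p ≤-refl ⟩
      ancestor (length p) p                 ≡⟨ ancestor-≥ ≤-refl ⟩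
      p                                     ∎

  step-up : ∀ {H p τ τ′} b → Fits ⟨ p , τ′ ⟩ → τ′ ≡ τ ⊎ (suc (length p) ≤ τ × length p ≤ τ′) →
            Covers H (b ∷ p) → Step H ⟨ b ∷ p , τ ⟩ ⟨ p , τ′ ⟩
  step-up {H} {p} b fits base cov = fits , (up b refl , base) , inj₂ visited
    where
    visited : ∀ w → b ∷ p ~ w → length w ≤ h → w ≢ p → H w
    visited w (down c refl) len _   = cov w (c ∷ [] , refl) len
    visited w (up c eq)     _   w≢p = contradiction (sym (∷-injectiveʳ eq)) w≢p

  run-tour : ∀ m p τ {H} rest → length p + m ≡ h → 1 ≤ τ → τ ≤ length p → H p →
             (∀ {H′} → H ⊆ H′ → Covers H′ p → Run H′ ⟨ p , τ ⟩ rest) →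
             Run H ⟨ p , τ ⟩ (tour m p τ rest)
  run-tour zero p τ rest len _ _ Hp k = k (λ x → x) (covers-leaf (trans (sym (+-identityʳ _)) len) Hp)
  run-tour (suc m) p τ {H} rest len 1≤τ τ≤p Hp k =
    step-down false p<h 1≤τ τ≤p ,
    run-tour m (false ∷ p) τ _ child-len 1≤τ (m≤n⇒m≤1+n τ≤p) (inj₂ refl) λ {H₀} H⊆H₀ cov₀ →
      step-up false fits (inj₁ refl) cov₀ ,
      step-down true p<h 1≤τ τ≤p ,
      run-tour m (true ∷ p) τ _ child-len 1≤τ (m≤n⇒m≤1+n τ≤p) (inj₂ refl) λ {H₁} H⊆H₁ cov₁ →
        step-up true fits (inj₁ refl) cov₁ ,
        k (inj₁ ∘ H⊆H₁ ∘ inj₁ ∘ inj₁ ∘ H⊆H₀ ∘ inj₁)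
          (covers-join (inj₂ refl) (covers-mono (inj₁ ∘ H⊆H₁ ∘ inj₁ ∘ inj₁) cov₀) (covers-mono inj₁ cov₁))
    where
    child-len : suc (length p) + m ≡ h
    child-len = trans (sym (+-suc (length p) m)) len
    p<h : length p < h
    p<h = ≤-trans (s≤s (m≤m+n (length p) m)) (≤-reflexive child-len)
    fits : Fits ⟨ p , τ ⟩
    fits = <⇒≤ p<h , 1≤τ

  step-onto-right-child : ∀ {H} d → d < h → Covers H (spine (suc d)) →
                          Step H ⟨ spine d , guard d ⟩ ⟨ true ∷ spine d , guard d ⟩
  step-onto-right-child {H} zero _ cov = (s≤s z≤n , s≤s z≤n) , (down true refl , inj₁ refl) , inj₂ visited
    where
    visited : ∀ w → [] ~ w → length w ≤ h → w ≢ true ∷ [] → H w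
    visited w (down false refl) len _  = cov w ⊑-refl len
    visited w (down true refl)  _   w≢ = contradiction refl w≢
  step-onto-right-child (suc d) d<h _ =
    step-down {p = spine (suc d)} true (subst (_< h) (sym (length-spine (suc d))) d<h) (s≤s z≤n)
      (≤-reflexive (sym (length-spine (suc d))))

  run-climb : ∀ d m {H} → d + m ≡ h → Covers H (spine d) → Run H ⟨ spine d , guard d ⟩ (climb d m)
  run-climb zero    m _ cov w len = cov w (w , ++-identityʳ w) len
  run-climb (suc d) m {H} len cov =
    step-up false fits (inj₂ (≤-reflexive (cong suc (length-spine d)) , length-spine≤guard d)) cov ,
    step-onto-right-child d d<h (covers-mono inj₁ cov) ,
    run-tour m (true ∷ spine d) (guard d) _ len′ (1≤guard d) (guard≤1+length-spine d) (inj₂ refl)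
      λ {H₁} H⊆H₁ cov₁ →
        step-up true fits (inj₁ refl) cov₁ ,
        run-climb d (suc m) (trans (+-suc d m) len)
          (covers-join (inj₂ refl) (covers-mono (inj₁ ∘ H⊆H₁ ∘ inj₁ ∘ inj₁) cov) (covers-mono inj₁ cov₁))
    where
    d<h : d < h
    d<h = ≤-trans (s≤s (m≤m+n d m)) (≤-reflexive len)
    len′ : length (true ∷ spine d) + m ≡ h
    len′ = trans (cong (λ i → suc (i + m)) (length-spine d)) len
    fits : Fits ⟨ spine d , guard d ⟩
    fits = ≤-trans (≤-reflexive (length-spine d)) (<⇒≤ d<h) , 1≤guard d

  visits-shift : ∀ {H : Pred Path 0ℓ} {c c′ cs t} →
                 (H ∪ ｛ tip c′ ｝) ∪ Visits c′ cs t ⊆ H ∪ Visits c (c′ ∷ cs) (suc t)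
  visits-shift (inj₁ (inj₁ Hw))      = inj₁ Hw
  visits-shift (inj₁ (inj₂ refl))    = inj₂ (1 , s≤s z≤n , refl)
  visits-shift (inj₂ (s , s≤t , eq)) = inj₂ (suc s , s≤s s≤t , eq)

  run⇒fits : ∀ {H c} cs → Fits c → Run H c cs → ∀ t → Fits (after c cs t)
  run⇒fits _         fits _                 zero    = fits
  run⇒fits []        fits _                 (suc t) = fits
  run⇒fits (c′ ∷ cs) _    ((fits′ , _) , run) (suc t) = run⇒fits cs fits′ run t

  run⇒step : ∀ {H c} cs → Run H c cs → ∀ t →
             after c cs (suc t) ≡ after c cs t ⊎ Step (H ∪ Visits c cs t) (after c cs t) (after c cs (suc t))
  run⇒step []        _          zero    = inj₁ refl
  run⇒step []        _          (suc t) = inj₁ refl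
  run⇒step (c′ ∷ cs) (step , _) zero    = inj₂ (step-mono inj₁ step)
  run⇒step {H} (c′ ∷ cs) (_ , run)  (suc t) with run⇒step cs run t
  ... | inj₁ eq   = inj₁ eq
  ... | inj₂ step = inj₂ (step-mono (visits-shift {H}) step)

  run⇒visits : ∀ {H c} cs → Run H c cs → ∀ w → length w ≤ h → (H ∪ Visits c cs (length cs)) w
  run⇒visits []        run       w len = inj₁ (run w len)
  run⇒visits {H} (c′ ∷ cs) (_ , run) w len = visits-shift {H} (run⇒visits cs run w len)

  x₀ : Config
  x₀ = ⟨ spine h , guard h ⟩

  walk : List Config
  walk = climb h 0

  run-walk : Run ｛ spine h ｝ x₀ walk
  run-walk = run-climb h 0 (+-identityʳ h) (covers-leaf (length-spine h) refl)

  config : ℕ → Config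
  config = after x₀ walk

  fits : ∀ t → Fits (config t)
  fits = run⇒fits walk (≤-reflexive (length-spine h) , s≤s z≤n) run-walk

  length-lionPath : ∀ t (l : Fin h) → length (lionPath (config t) (toℕ l)) ≤ h
  length-lionPath t l = ≤-trans (length-ancestor (base (config t) + toℕ l) (tip (config t))) (proj₁ (fits t))

  position : ℕ → Fin h → Vertex
  position t l = vertex (lionPath (config t) (toℕ l)) (length-lionPath t l)

  path-position : ∀ t l → path (position t l) ≡ lionPath (config t) (toℕ l)
  path-position t l = path-vertex (lionPath (config t) (toℕ l)) (length-lionPath t l)

  position-≡ : ∀ t l t′ l′ → lionPath (config t) (toℕ l) ≡ lionPath (config t′) (toℕ l′) →
               position t l ≡ position t′ l′
  position-≡ t l t′ l′ eq = path-injective (trans (path-position t l) (trans eq (sym (path-position t′ l′))))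

  position-move : ∀ t l →
                  position (suc t) l ≡ position t l ⊎ Adj (BinaryTree h) (position t l) (position (suc t) l)
  position-move t l with run⇒step walk run-walk t
  ... | inj₁ eq = inj₁ (position-≡ (suc t) l t l (cong (λ c → lionPath c (toℕ l)) eq))
  ... | inj₂ (_ , moves , _) with lion-stays-or-follows moves (toℕ l)
  ...   | inj₁ eq          = inj₁ (position-≡ (suc t) l t l eq)
  ...   | inj₂ (from , to) = inj₂ (~⇒adj (subst₂ _~_ (sym (trans (path-position t l) from))
                                                   (sym (trans (path-position (suc t) l) to)) (proj₁ moves)))

  strategy : Strategy (BinaryTree h) h
  strategy = record { pos = position ; move = position-move }

  top : Fin h
  top = fromℕ h′

  top-at-tip : ∀ t → path (position t top) ≡ tip (config t)
  top-at-tip t = begin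
    path (position t top)            ≡⟨ path-position t top ⟩
    lionPath (config t) (toℕ top)    ≡⟨ cong (lionPath (config t)) (toℕ-fromℕ h′) ⟩
    lionPath (config t) h′           ≡⟨ ancestor-≥ (≤-trans tip≤h (+-monoˡ-≤ h′ 1≤base)) ⟩
    tip (config t)                   ∎
    where
    open ≡-Reasoning
    tip≤h : length (tip (config t)) ≤ h
    tip≤h = proj₁ (fits t)
    1≤base : 1 ≤ base (config t)
    1≤base = proj₂ (fits t)

  history⇒visited : ∀ {t v} → (｛ tip x₀ ｝ ∪ Visits x₀ walk t) (path v) → Visited strategy t v
  history⇒visited (inj₁ eq)             = 0 , z≤n , top , path-injective (trans (top-at-tip 0) eq)
  history⇒visited (inj₂ (s , s≤t , eq)) = s , s≤t , top , path-injective (trans (top-at-tip s) eq)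

  vacates-safely : SafeVacating strategy
  vacates-safely t v (l , at-v) ¬o′ w adj with run⇒step walk run-walk t
  ... | inj₁ eq =
    contradiction (l , trans (position-≡ (suc t) l t l (cong (λ c → lionPath c (toℕ l)) eq)) at-v) ¬o′
  ... | inj₂ (_ , moves , guarded) with lion-stays-or-follows moves (toℕ l)
  ...   | inj₁ eq        = contradiction (l , trans (position-≡ (suc t) l t l eq) at-v) ¬o′
  ...   | inj₂ (from , _) = vacated guarded
    where
    v-tip : path v ≡ tip (config t)
    v-tip = trans (cong path (sym at-v)) (trans (path-position t l) from)
    vacated : Guarded (｛ tip x₀ ｝ ∪ Visits x₀ walk t) (config t) (config (suc t)) →
              Visited strategy t w ⊎ Moved strategy t v w
    vacated (inj₁ (l′ , stays)) =
      contradiction (l′ , path-injective (trans (path-position (suc t) l′) (trans stays (sym v-tip)))) ¬o′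
    vacated (inj₂ visited) with ≡-dec Bool._≟_ (path w) (tip (config (suc t)))
    ... | yes w-tip = inj₂ (top , path-injective (trans (top-at-tip t) (sym v-tip)) ,
                                  path-injective (trans (top-at-tip (suc t)) (sym w-tip)))
    ... | no  w≢    =
      inj₁ (history⇒visited (visited (path w) (subst (_~ path w) v-tip (adj⇒~ adj)) (length-path w) w≢))

  clearable : MonotoneClearable (BinaryTree h) h
  clearable = strategy , safe⇒monotone strategy vacates-safely ,
              safe⇒clears strategy vacates-safely (length walk)
                λ v → history⇒visited (run⇒visits walk run-walk (path v) (length-path v))

lemma30 : (h : ℕ) → 1 ≤ h → MonotoneLionNumber (BinaryTree h) h
lemma30 zero    ()
lemma30 (suc h′) 1≤h = (1≤h , UpperBound.clearable h′) ,
  λ k _ (S , mono , clears) → LowerBound.h≤k S mono clears
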